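{- For all integers $n$, $r$ with $n\ge r+1>0$, \[ (r+1)\tilde{w}_{n,r+1}=\sum_{j=r}^{n-1}\binom{n}{j}w_{n-j}\bigl(\tilde{w}_{j,r}-(r+1)\tilde{w}_{j,r+1}\bigr). \]
   Context: ${n\brace k}$ denotes the Stirling number of the second kind. $w_n=\sum_{k=0}^n{n\brace k}k!$ are the ordered Bell numbers. $d_{k,r}$ is the number of permutations of a $k$-set with exactly $r$ fixed points ($d_{k,r}=\binom{k}{r}d_{k-r}$ for $k\ge r$, $0$ otherwise, $d_m=m!\sum_{i=0}^m(-1)^i/i!$), and $\tilde{w}_{n,r}=\sum_{k=0}^n{n\brace k}d_{k,r}$. -}

module Defs where

open import Data.Nat using (ℕ; zero; suc; _+_; _*_; _∸_; _!; _/_; _≤?_)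
open import Relation.Nullary using (yes; no)
open import Data.Nat.Properties using (_!≢0)
open import Data.Nat.Combinatorics using (_C_)
open import Data.Integer as ℤ using (ℤ; +_)

sumℕ : ℕ → (ℕ → ℕ) → ℕ
sumℕ zero    f = 0
sumℕ (suc n) f = sumℕ n f + f n

sumℤ : ℕ → (ℕ → ℤ) → ℤ
sumℤ zero    f = + 0
sumℤ (suc n) f = sumℤ n f ℤ.+ f n

-- Σ_{j=a}^{b-1} f j  (integers); empty if b ≤ a
sumRangeℤ : ℕ → ℕ → (ℕ → ℤ) → ℤ
sumRangeℤ a b f = sumℤ (b ∸ a) (λ i → f (a + i))

S2 : ℕ → ℕ → ℕ
S2 zero    zero    = 1
S2 zero    (suc k) = 0
S2 (suc n) zero    = 0
S2 (suc n) (suc k) = suc k * S2 n (suc k) + S2 n k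

w : ℕ → ℕ
w n = sumℕ (suc n) (λ k → S2 n k * k !)

sgn : ℕ → ℤ
sgn zero    = + 1
sgn (suc i) = ℤ.- sgn i

-- derangement numbers  d_m = m! Σ_{i=0}^m (-1)^i / i!  =  Σ_{i=0}^m (-1)^i (m!/i!)
der : ℕ → ℤ
der m = sumℤ (suc m) (λ i → sgn i ℤ.* + ((m !) / (i !)) {{i !≢0}})

-- d_{k,r}: permutations of a k-set with exactly r fixed points
dkr : ℕ → ℕ → ℤ
dkr k r with r ≤? k
... | yes _ = + (k C r) ℤ.* der (k ∸ r)
... | no  _ = + 0

wt : ℕ → ℕ → ℤ
wt n r = sumℤ (suc n) (λ k → + S2 n k ℤ.* dkr k r)

{-# OPTIONS --safe #-}
module Submission where

open import Defs
open import Data.Nat using (ℕ; suc; _≤_; _∸_)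
open import Data.Nat.Combinatorics using (_C_)
open import Data.Integer using (ℤ; +_; _*_; _-_)
open import Relation.Binary.PropositionalEquality using (_≡_)

open import Data.Nat as ℕ using (zero; _<_; z≤n; s≤s; _!)
import Data.Nat.Properties as ℕP
import Data.Nat.Tactic.RingSolver as ℕ-Solver
open import Data.Nat.Combinatorics using (nCk+nC[k+1]≡[n+1]C[k+1]; k>n⇒nCk≡0; nC1≡n; nCn≡1)
open import Data.Integer using (_+_)
import Data.Integer.Properties as ℤP
open import Data.Integer.Tactic.RingSolver using (solve-∀)
import Algebra.Properties.CommutativeSemigroup as CommutativeSemigroupProperties
open import Algebra.Properties.Ring ℤP.+-*-ring using (x[y-z]≈xy-xz; [y-z]x≈yx-zx)
open import Data.Empty using (⊥-elim)
open import Data.Sum using (inj₁; inj₂)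
open import Relation.Binary.PropositionalEquality using (refl; sym; trans; cong; cong₂; module ≡-Reasoning)
open import Relation.Nullary using (yes; no)

-- Read a sequence f as the exponential generating function Σ f(n) xⁿ/n!, so
-- that the binomial convolution (f ⋆ g) n = Σⱼ C(n,j) g(n−j) f(j) is the
-- product of EGFs.  The Stirling transform Σₖ S(n,k) f(k) substitutes eˣ − 1
-- into the EGF of f; hence its convolution with u = eˣ − 1 is the Stirling
-- transform of the sequence whose EGF is x times that of f.  For f(k) = k!
-- this gives w ⋆ u = w − δ, i.e. w ⋆ (δ − u) = δ.  For f(k) = d_{k,r} it gives
-- w̃_{·,r} ⋆ u = (r+1) w̃_{·,r+1}, because x Σₖ d_{k,r} xᵏ/k! = (r+1) Σₖ d_{k,r+1} xᵏ/k!.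
-- So c = w̃_{·,r} − (r+1) w̃_{·,r+1} = w̃_{·,r} ⋆ (δ − u), whence c ⋆ w = w̃_{·,r}.
-- The term j = n of c ⋆ w is c(n), and the terms j < r vanish.

module +-CS = CommutativeSemigroupProperties ℤP.+-commutativeSemigroup
module *-CS = CommutativeSemigroupProperties ℤP.*-commutativeSemigroup

Seq : Set
Seq = ℕ → ℤ

x-[x-y]≡y : ∀ x y → x - (x - y) ≡ y
x-[x-y]≡y = solve-∀

x+y-y≡x : ∀ x y → x + y - y ≡ x
x+y-y≡x = solve-∀

sumℤ-cong : ∀ n {f g : Seq} → (∀ i → i < n → f i ≡ g i) → sumℤ n f ≡ sumℤ n g
sumℤ-cong zero    f≡g = refl
sumℤ-cong (suc n) f≡g =
  cong₂ _+_ (sumℤ-cong n (λ i i<n → f≡g i (ℕP.m<n⇒m<1+n i<n))) (f≡g n (ℕP.n<1+n n))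

sumℤ-zero : ∀ n {f : Seq} → (∀ i → i < n → f i ≡ + 0) → sumℤ n f ≡ + 0
sumℤ-zero zero    f≡0 = refl
sumℤ-zero (suc n) f≡0 =
  cong₂ _+_ (sumℤ-zero n (λ i i<n → f≡0 i (ℕP.m<n⇒m<1+n i<n))) (f≡0 n (ℕP.n<1+n n))

sumℤ-distrib-+ : ∀ n (f g : Seq) → sumℤ n (λ i → f i + g i) ≡ sumℤ n f + sumℤ n g
sumℤ-distrib-+ zero    f g = refl
sumℤ-distrib-+ (suc n) f g =
  trans (cong (_+ (f n + g n)) (sumℤ-distrib-+ n f g)) (+-CS.interchange (sumℤ n f) (sumℤ n g) (f n) (g n))

sumℤ-distrib-- : ∀ n (f g : Seq) → sumℤ n (λ i → f i - g i) ≡ sumℤ n f - sumℤ n g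
sumℤ-distrib-- zero    f g = refl
sumℤ-distrib-- (suc n) f g =
  trans (cong (_+ (f n - g n)) (sumℤ-distrib-- n f g)) (regroup (sumℤ n f) (sumℤ n g) (f n) (g n))
  where
  regroup : ∀ a b c d → (a - b) + (c - d) ≡ (a + c) - (b + d)
  regroup = solve-∀

*-distribˡ-sumℤ : ∀ n c (f : Seq) → c * sumℤ n f ≡ sumℤ n (λ i → c * f i)
*-distribˡ-sumℤ zero    c f = ℤP.*-zeroʳ c
*-distribˡ-sumℤ (suc n) c f =
  trans (ℤP.*-distribˡ-+ c (sumℤ n f) (f n)) (cong (_+ c * f n) (*-distribˡ-sumℤ n c f))

*-distribʳ-sumℤ : ∀ n c (f : Seq) → sumℤ n f * c ≡ sumℤ n (λ i → f i * c)
*-distribʳ-sumℤ zero    c f = refl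
*-distribʳ-sumℤ (suc n) c f =
  trans (ℤP.*-distribʳ-+ c (sumℤ n f) (f n)) (cong (_+ f n * c) (*-distribʳ-sumℤ n c f))

sumℤ-head : ∀ n (f : Seq) → sumℤ (suc n) f ≡ f 0 + sumℤ n (λ i → f (suc i))
sumℤ-head zero    f = ℤP.+-comm (+ 0) (f 0)
sumℤ-head (suc n) f =
  trans (cong (_+ f (suc n)) (sumℤ-head n f)) (ℤP.+-assoc (f 0) (sumℤ n (λ i → f (suc i))) (f (suc n)))

sumℤ-comm : ∀ m n (F : ℕ → Seq) → sumℤ m (λ i → sumℤ n (F i)) ≡ sumℤ n (λ j → sumℤ m (λ i → F i j))
sumℤ-comm zero    n F = sym (sumℤ-zero n (λ _ _ → refl))
sumℤ-comm (suc m) n F =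
  trans (cong (_+ sumℤ n (F m)) (sumℤ-comm m n F)) (sym (sumℤ-distrib-+ n (λ j → sumℤ m (λ i → F i j)) (F m)))

sumℤ-split : ∀ m k (f : Seq) → sumℤ (m ℕ.+ k) f ≡ sumℤ m f + sumℤ k (λ i → f (m ℕ.+ i))
sumℤ-split m zero f rewrite ℕP.+-identityʳ m = sym (ℤP.+-identityʳ (sumℤ m f))
sumℤ-split m (suc k) f rewrite ℕP.+-suc m k =
  trans (cong (_+ f (m ℕ.+ k)) (sumℤ-split m k f))
        (ℤP.+-assoc (sumℤ m f) (sumℤ k (λ i → f (m ℕ.+ i))) (f (m ℕ.+ k)))

sumℤ-extend : ∀ m n (f : Seq) → m ≤ n → (∀ i → m ≤ i → i < n → f i ≡ + 0) → sumℤ m f ≡ sumℤ n f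
sumℤ-extend m zero    f z≤n    f≡0 = refl
sumℤ-extend m (suc n) f m≤1+n f≡0 with ℕP.m≤n⇒m<n∨m≡n m≤1+n
... | inj₂ refl      = refl
... | inj₁ (s≤s m≤n) = begin
    sumℤ m f             ≡⟨ sumℤ-extend m n f m≤n (λ i m≤i i<n → f≡0 i m≤i (ℕP.m<n⇒m<1+n i<n)) ⟩
    sumℤ n f             ≡⟨ ℤP.+-identityʳ (sumℤ n f) ⟨
    sumℤ n f + + 0       ≡⟨ cong (_+_ (sumℤ n f)) (f≡0 n m≤n (ℕP.n<1+n n)) ⟨
    sumℤ (suc n) f       ∎
  where open ≡-Reasoning

sumRangeℤ≡sumℤ : ∀ r n (f : Seq) → r ≤ n → (∀ j → j < r → f j ≡ + 0) → sumRangeℤ r n f ≡ sumℤ n f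
sumRangeℤ≡sumℤ r n f r≤n f≡0 = begin
    sumRangeℤ r n f                 ≡⟨ ℤP.+-identityˡ (sumRangeℤ r n f) ⟨
    + 0 + sumRangeℤ r n f           ≡⟨ cong (_+ sumRangeℤ r n f) (sumℤ-zero r f≡0) ⟨
    sumℤ r f + sumRangeℤ r n f      ≡⟨ sumℤ-split r (n ∸ r) f ⟨
    sumℤ (r ℕ.+ (n ∸ r)) f          ≡⟨ cong (λ k → sumℤ k f) (ℕP.m+[n∸m]≡n r≤n) ⟩
    sumℤ n f                        ∎
  where open ≡-Reasoning

pos-sumℕ : ∀ n (f : ℕ → ℕ) → + sumℕ n f ≡ sumℤ n (λ i → + f i)
pos-sumℕ zero    f = refl
pos-sumℕ (suc n) f = trans (ℤP.pos-+ (sumℕ n f) (f n)) (cong (_+ + f n) (pos-sumℕ n f))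

infixl 7 _⋆_

_⋆_ : Seq → Seq → Seq
(f ⋆ g) n = sumℤ (suc n) (λ j → + (n C j) * g (n ∸ j) * f j)

shift : Seq → Seq
shift f n = f (suc n)

δ : Seq
δ zero    = + 1
δ (suc _) = + 0

u : Seq
u zero    = + 0
u (suc _) = + 1

⋆-cong : ∀ n {f f′ g g′ : Seq} → (∀ m → m ≤ n → f m ≡ f′ m) → (∀ m → m ≤ n → g m ≡ g′ m) →
         (f ⋆ g) n ≡ (f′ ⋆ g′) n
⋆-cong n f≡f′ g≡g′ = sumℤ-cong (suc n) (λ j j≤n →
  cong₂ _*_ (cong (+ (n C j) *_) (g≡g′ (n ∸ j) (ℕP.m∸n≤m n j))) (f≡f′ j (ℕP.≤-pred j≤n)))

⋆-congˡ : ∀ n {f f′ : Seq} (g : Seq) → (∀ m → m ≤ n → f m ≡ f′ m) → (f ⋆ g) n ≡ (f′ ⋆ g) n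
⋆-congˡ n g f≡f′ = ⋆-cong n {g = g} f≡f′ (λ _ _ → refl)

⋆-congʳ : ∀ n (f : Seq) {g g′ : Seq} → (∀ m → m ≤ n → g m ≡ g′ m) → (f ⋆ g) n ≡ (f ⋆ g′) n
⋆-congʳ n f g≡g′ = ⋆-cong n {f = f} (λ _ _ → refl) g≡g′

⋆-distribʳ-+ : ∀ n (f f′ g : Seq) → ((λ m → f m + f′ m) ⋆ g) n ≡ (f ⋆ g) n + (f′ ⋆ g) n
⋆-distribʳ-+ n f f′ g = trans
  (sumℤ-cong (suc n) (λ j _ → ℤP.*-distribˡ-+ (+ (n C j) * g (n ∸ j)) (f j) (f′ j)))
  (sumℤ-distrib-+ (suc n) _ _)

⋆-distribˡ-+ : ∀ n (f g g′ : Seq) → (f ⋆ (λ m → g m + g′ m)) n ≡ (f ⋆ g) n + (f ⋆ g′) n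
⋆-distribˡ-+ n f g g′ = trans
  (sumℤ-cong (suc n) (λ j _ → trans (cong (_* f j) (ℤP.*-distribˡ-+ (+ (n C j)) (g (n ∸ j)) (g′ (n ∸ j))))
                                     (ℤP.*-distribʳ-+ (f j) (+ (n C j) * g (n ∸ j)) (+ (n C j) * g′ (n ∸ j)))))
  (sumℤ-distrib-+ (suc n) _ _)

⋆-distribʳ-- : ∀ n (f f′ g : Seq) → ((λ m → f m - f′ m) ⋆ g) n ≡ (f ⋆ g) n - (f′ ⋆ g) n
⋆-distribʳ-- n f f′ g = trans
  (sumℤ-cong (suc n) (λ j _ → x[y-z]≈xy-xz (+ (n C j) * g (n ∸ j)) (f j) (f′ j)))
  (sumℤ-distrib-- (suc n) _ _)

⋆-distribˡ-- : ∀ n (f g g′ : Seq) → (f ⋆ (λ m → g m - g′ m)) n ≡ (f ⋆ g) n - (f ⋆ g′) n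
⋆-distribˡ-- n f g g′ = trans
  (sumℤ-cong (suc n) (λ j _ → trans (cong (_* f j) (x[y-z]≈xy-xz (+ (n C j)) (g (n ∸ j)) (g′ (n ∸ j))))
                                     ([y-z]x≈yx-zx (f j) (+ (n C j) * g (n ∸ j)) (+ (n C j) * g′ (n ∸ j)))))
  (sumℤ-distrib-- (suc n) _ _)

*-⋆ : ∀ n c (f g : Seq) → ((λ m → c * f m) ⋆ g) n ≡ c * (f ⋆ g) n
*-⋆ n c f g = trans
  (sumℤ-cong (suc n) (λ j _ → *-CS.x∙yz≈y∙xz (+ (n C j) * g (n ∸ j)) c (f j)))
  (sym (*-distribˡ-sumℤ (suc n) c _))

⋆-*ʳ : ∀ n c (f g : Seq) → ((λ m → f m * c) ⋆ g) n ≡ (f ⋆ g) n * c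
⋆-*ʳ n c f g = trans
  (sumℤ-cong (suc n) (λ j _ → sym (ℤP.*-assoc (+ (n C j) * g (n ∸ j)) (f j) c)))
  (sym (*-distribʳ-sumℤ (suc n) c _))

⋆-zeroˡ : ∀ n (g : Seq) → ((λ _ → + 0) ⋆ g) n ≡ + 0
⋆-zeroˡ n g = sumℤ-zero (suc n) (λ j _ → ℤP.*-zeroʳ (+ (n C j) * g (n ∸ j)))

⋆-zeroʳ : ∀ n (f : Seq) → (f ⋆ (λ _ → + 0)) n ≡ + 0
⋆-zeroʳ n f = sumℤ-zero (suc n) (λ j _ → cong (_* f j) (ℤP.*-zeroʳ (+ (n C j))))

sumℤ-⋆ : ∀ N (F : ℕ → Seq) (g : Seq) n → ((λ m → sumℤ N (λ k → F k m)) ⋆ g) n ≡ sumℤ N (λ k → (F k ⋆ g) n)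
sumℤ-⋆ N F g n = trans
  (sumℤ-cong (suc n) (λ j _ → *-distribˡ-sumℤ N (+ (n C j) * g (n ∸ j)) (λ k → F k j)))
  (sumℤ-comm (suc n) N _)

⋆-leibniz : ∀ n (f g : Seq) → (f ⋆ g) (suc n) ≡ (shift f ⋆ g) n + (f ⋆ shift g) n
⋆-leibniz n f g = begin
    (f ⋆ g) (suc n)
  ≡⟨ sumℤ-head (suc n) T ⟩
    T 0 + sumℤ (suc n) (λ j → T (suc j))
  ≡⟨ cong (_+_ (T 0)) (trans (sumℤ-cong (suc n) (λ j _ → pascal j)) (sumℤ-distrib-+ (suc n) _ P)) ⟩
    T 0 + ((shift f ⋆ g) n + sumℤ (suc n) P)
  ≡⟨ +-CS.x∙yz≈y∙xz (T 0) ((shift f ⋆ g) n) (sumℤ (suc n) P) ⟩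
    (shift f ⋆ g) n + (T 0 + sumℤ (suc n) P)
  ≡⟨ cong (λ z → (shift f ⋆ g) n + (T 0 + z)) P-shift ⟩
    (shift f ⋆ g) n + (T 0 + sumℤ n (λ j → Q (suc j)))
  ≡⟨ cong (_+_ ((shift f ⋆ g) n)) (sumℤ-head n Q) ⟨
    (shift f ⋆ g) n + (f ⋆ shift g) n
  ∎
  where
  open ≡-Reasoning
  T P Q : Seq
  T j = + (suc n C j) * g (suc n ∸ j) * f j
  P j = + (n C suc j) * g (n ∸ j) * f (suc j)
  Q j = + (n C j) * g (suc (n ∸ j)) * f j

  pascal : ∀ j → T (suc j) ≡ + (n C j) * g (n ∸ j) * f (suc j) + P j
  pascal j = trans
    (cong (λ z → z * g (n ∸ j) * f (suc j))
          (trans (cong +_ (sym (nCk+nC[k+1]≡[n+1]C[k+1] n j))) (ℤP.pos-+ (n C j) (n C suc j))))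
    (distrib (+ (n C j)) (+ (n C suc j)) (g (n ∸ j)) (f (suc j)))
    where
    distrib : ∀ a b x y → (a + b) * x * y ≡ a * x * y + b * x * y
    distrib = solve-∀

  P-shift : sumℤ (suc n) P ≡ sumℤ n (λ j → Q (suc j))
  P-shift = begin
      sumℤ n P + P n  ≡⟨ cong (λ z → sumℤ n P + + z * g (n ∸ n) * f (suc n)) (k>n⇒nCk≡0 (ℕP.n<1+n n)) ⟩
      sumℤ n P + + 0  ≡⟨ ℤP.+-identityʳ (sumℤ n P) ⟩
      sumℤ n P        ≡⟨ sumℤ-cong n (λ j j<n → cong (λ z → + (n C suc j) * g z * f (suc j)) (ℕP.+-∸-assoc 1 j<n)) ⟩
      sumℤ n (λ j → Q (suc j)) ∎

⋆-comm : ∀ n (f g : Seq) → (f ⋆ g) n ≡ (g ⋆ f) n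
⋆-comm zero    f g = swap (f 0) (g 0)
  where
  swap : ∀ a b → + 0 + + 1 * b * a ≡ + 0 + + 1 * a * b
  swap = solve-∀
⋆-comm (suc n) f g = begin
    (f ⋆ g) (suc n)                          ≡⟨ ⋆-leibniz n f g ⟩
    (shift f ⋆ g) n + (f ⋆ shift g) n        ≡⟨ cong₂ _+_ (⋆-comm n (shift f) g) (⋆-comm n f (shift g)) ⟩
    (g ⋆ shift f) n + (shift g ⋆ f) n        ≡⟨ ℤP.+-comm ((g ⋆ shift f) n) ((shift g ⋆ f) n) ⟩
    (shift g ⋆ f) n + (g ⋆ shift f) n        ≡⟨ ⋆-leibniz n g f ⟨
    (g ⋆ f) (suc n)                          ∎
  where open ≡-Reasoning

⋆-identityʳ : ∀ n (f : Seq) → (f ⋆ δ) n ≡ f n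
⋆-identityʳ zero    f = base (f 0)
  where
  base : ∀ a → + 0 + + 1 * + 1 * a ≡ a
  base = solve-∀
⋆-identityʳ (suc n) f = begin
    (f ⋆ δ) (suc n)                   ≡⟨ ⋆-leibniz n f δ ⟩
    (shift f ⋆ δ) n + (f ⋆ shift δ) n ≡⟨ cong₂ _+_ (⋆-identityʳ n (shift f)) (⋆-zeroʳ n f) ⟩
    f (suc n) + + 0                   ≡⟨ ℤP.+-identityʳ (f (suc n)) ⟩
    f (suc n)                         ∎
  where open ≡-Reasoning

⋆-assoc : ∀ n (f g h : Seq) → ((f ⋆ g) ⋆ h) n ≡ (f ⋆ (g ⋆ h)) n
⋆-assoc zero    f g h = base (f 0) (g 0) (h 0)
  where
  base : ∀ a b c → + 0 + + 1 * c * (+ 0 + + 1 * b * a) ≡ + 0 + + 1 * (+ 0 + + 1 * c * b) * a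
  base = solve-∀
⋆-assoc (suc n) f g h = begin
    ((f ⋆ g) ⋆ h) (suc n)
  ≡⟨ ⋆-leibniz n (f ⋆ g) h ⟩
    (shift (f ⋆ g) ⋆ h) n + ((f ⋆ g) ⋆ shift h) n
  ≡⟨ cong (_+ ((f ⋆ g) ⋆ shift h) n) (⋆-congˡ n h (λ m _ → ⋆-leibniz m f g)) ⟩
    ((λ m → (shift f ⋆ g) m + (f ⋆ shift g) m) ⋆ h) n + ((f ⋆ g) ⋆ shift h) n
  ≡⟨ cong (_+ ((f ⋆ g) ⋆ shift h) n) (⋆-distribʳ-+ n (shift f ⋆ g) (f ⋆ shift g) h) ⟩
    ((shift f ⋆ g) ⋆ h) n + ((f ⋆ shift g) ⋆ h) n + ((f ⋆ g) ⋆ shift h) n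
  ≡⟨ cong₂ _+_ (cong₂ _+_ (⋆-assoc n (shift f) g h) (⋆-assoc n f (shift g) h)) (⋆-assoc n f g (shift h)) ⟩
    (shift f ⋆ (g ⋆ h)) n + (f ⋆ (shift g ⋆ h)) n + (f ⋆ (g ⋆ shift h)) n
  ≡⟨ ℤP.+-assoc ((shift f ⋆ (g ⋆ h)) n) ((f ⋆ (shift g ⋆ h)) n) ((f ⋆ (g ⋆ shift h)) n) ⟩
    (shift f ⋆ (g ⋆ h)) n + ((f ⋆ (shift g ⋆ h)) n + (f ⋆ (g ⋆ shift h)) n)
  ≡⟨ cong (_+_ ((shift f ⋆ (g ⋆ h)) n)) (⋆-distribˡ-+ n f (shift g ⋆ h) (g ⋆ shift h)) ⟨
    (shift f ⋆ (g ⋆ h)) n + (f ⋆ (λ m → (shift g ⋆ h) m + (g ⋆ shift h) m)) n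
  ≡⟨ cong (_+_ ((shift f ⋆ (g ⋆ h)) n)) (⋆-congʳ n f (λ m _ → ⋆-leibniz m g h)) ⟨
    (shift f ⋆ (g ⋆ h)) n + (f ⋆ shift (g ⋆ h)) n
  ≡⟨ ⋆-leibniz n f (g ⋆ h) ⟨
    (f ⋆ (g ⋆ h)) (suc n)
  ∎
  where open ≡-Reasoning

⋆-shift-u : ∀ n (f : Seq) → (f ⋆ u) (suc n) ≡ (shift f ⋆ u) n + (f n + (f ⋆ u) n)
⋆-shift-u n f = begin
    (f ⋆ u) (suc n)                                   ≡⟨ ⋆-leibniz n f u ⟩
    (shift f ⋆ u) n + (f ⋆ shift u) n                 ≡⟨ cong (_+_ ((shift f ⋆ u) n)) (⋆-congʳ n f one≡δ+u) ⟩
    (shift f ⋆ u) n + (f ⋆ (λ m → δ m + u m)) n       ≡⟨ cong (_+_ ((shift f ⋆ u) n)) (⋆-distribˡ-+ n f δ u) ⟩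
    (shift f ⋆ u) n + ((f ⋆ δ) n + (f ⋆ u) n)         ≡⟨ cong (λ z → (shift f ⋆ u) n + (z + (f ⋆ u) n)) (⋆-identityʳ n f) ⟩
    (shift f ⋆ u) n + (f n + (f ⋆ u) n)               ∎
  where
  open ≡-Reasoning
  one≡δ+u : ∀ m → m ≤ n → shift u m ≡ δ m + u m
  one≡δ+u zero    _ = refl
  one≡δ+u (suc m) _ = refl

⋆-u-cancel : ∀ {v : Seq} → (∀ m → (v ⋆ u) m ≡ v m - δ m) →
             ∀ (a : Seq) n → ((λ m → a m - (a ⋆ u) m) ⋆ v) n ≡ a n
⋆-u-cancel {v} v⋆u≡v-δ a n = begin
    ((λ m → a m - (a ⋆ u) m) ⋆ v) n     ≡⟨ ⋆-distribʳ-- n a (a ⋆ u) v ⟩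
    (a ⋆ v) n - ((a ⋆ u) ⋆ v) n         ≡⟨ cong (_-_ ((a ⋆ v) n)) (⋆-assoc n a u v) ⟩
    (a ⋆ v) n - (a ⋆ (u ⋆ v)) n         ≡⟨ cong (_-_ ((a ⋆ v) n)) (⋆-congʳ n a u⋆v≡v-δ) ⟩
    (a ⋆ v) n - (a ⋆ (λ m → v m - δ m)) n ≡⟨ cong (_-_ ((a ⋆ v) n)) (⋆-distribˡ-- n a v δ) ⟩
    (a ⋆ v) n - ((a ⋆ v) n - (a ⋆ δ) n) ≡⟨ x-[x-y]≡y ((a ⋆ v) n) ((a ⋆ δ) n) ⟩
    (a ⋆ δ) n                           ≡⟨ ⋆-identityʳ n a ⟩
    a n                                 ∎
  where
  open ≡-Reasoning
  u⋆v≡v-δ : ∀ m → m ≤ n → (u ⋆ v) m ≡ v m - δ m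
  u⋆v≡v-δ m _ = trans (⋆-comm m u v) (v⋆u≡v-δ m)

n<k⇒S2nk≡0 : ∀ {n k} → n < k → S2 n k ≡ 0
n<k⇒S2nk≡0 {zero}  {suc k} _         = refl
n<k⇒S2nk≡0 {suc n} {suc k} (s≤s n<k)
  rewrite n<k⇒S2nk≡0 (ℕP.m<n⇒m<1+n n<k) | n<k⇒S2nk≡0 n<k =
  trans (ℕP.+-identityʳ (suc k ℕ.* 0)) (ℕP.*-zeroʳ (suc k))

column : ℕ → Seq
column k n = + S2 n k

column-suc : ∀ n k → column (suc k) (suc n) ≡ + suc k * column (suc k) n + column k n
column-suc n k = trans (ℤP.pos-+ (suc k ℕ.* S2 n (suc k)) (S2 n k))
                       (cong (_+ column k n) (ℤP.pos-* (suc k) (S2 n (suc k))))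

-- The EGF of column k is (eˣ − 1)ᵏ/k!.
column-⋆-u : ∀ n k → (column k ⋆ u) n ≡ + suc k * column (suc k) n
column-⋆-u zero    k = sym (ℤP.*-zeroʳ (+ suc k))
column-⋆-u (suc n) k = begin
    (column k ⋆ u) (suc n)
  ≡⟨ ⋆-shift-u n (column k) ⟩
    (shift (column k) ⋆ u) n + (column k n + (column k ⋆ u) n)
  ≡⟨ cong₂ _+_ (shift-column-⋆-u k) (cong (_+_ (column k n)) (column-⋆-u n k)) ⟩
    + k * (+ suc k * column (suc k) n) + + k * column k n + (column k n + + suc k * column (suc k) n)
  ≡⟨ collect (+ k) (column (suc k) n) (column k n) ⟩
    + suc k * (+ suc k * column (suc k) n + column k n)
  ≡⟨ cong (+ suc k *_) (column-suc n k) ⟨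
    + suc k * column (suc k) (suc n)
  ∎
  where
  open ≡-Reasoning
  shift-column-⋆-u : ∀ k → (shift (column k) ⋆ u) n ≡ + k * (+ suc k * column (suc k) n) + + k * column k n
  shift-column-⋆-u zero    = ⋆-zeroˡ n u
  shift-column-⋆-u (suc k) = begin
      (shift (column (suc k)) ⋆ u) n
    ≡⟨ ⋆-congˡ n u (λ m _ → column-suc m k) ⟩
      ((λ m → + suc k * column (suc k) m + column k m) ⋆ u) n
    ≡⟨ ⋆-distribʳ-+ n (λ m → + suc k * column (suc k) m) (column k) u ⟩
      ((λ m → + suc k * column (suc k) m) ⋆ u) n + (column k ⋆ u) n
    ≡⟨ cong₂ _+_ (trans (*-⋆ n (+ suc k) (column (suc k)) u) (cong (+ suc k *_) (column-⋆-u n (suc k))))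
                 (column-⋆-u n k) ⟩
      + suc k * (+ suc (suc k) * column (suc (suc k)) n) + + suc k * column (suc k) n
    ∎
  collect : ∀ K X Y → K * ((+ 1 + K) * X) + K * Y + (Y + (+ 1 + K) * X) ≡ (+ 1 + K) * ((+ 1 + K) * X + Y)
  collect = solve-∀

stirling : Seq → Seq
stirling f n = sumℤ (suc n) (λ k → column k n * f k)

stirling-extend : ∀ f {n} N → n < N → stirling f n ≡ sumℤ N (λ k → column k n * f k)
stirling-extend f N n<N = sumℤ-extend _ N _ n<N (λ k n<k _ → cong (λ s → + s * f k) (n<k⇒S2nk≡0 n<k))

mulX : Seq → Seq
mulX f zero    = + 0
mulX f (suc k) = + suc k * f k

stirling-⋆-u : ∀ f n → (stirling f ⋆ u) n ≡ stirling (mulX f) n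
stirling-⋆-u f n = begin
    (stirling f ⋆ u) n
  ≡⟨ ⋆-congˡ n u (λ m m≤n → stirling-extend f (suc n) (s≤s m≤n)) ⟩
    ((λ m → sumℤ (suc n) (λ k → column k m * f k)) ⋆ u) n
  ≡⟨ sumℤ-⋆ (suc n) (λ k m → column k m * f k) u n ⟩
    sumℤ (suc n) (λ k → ((λ m → column k m * f k) ⋆ u) n)
  ≡⟨ sumℤ-cong (suc n) (λ k _ → trans (⋆-*ʳ n (f k) (column k) u) (cong (_* f k) (column-⋆-u n k))) ⟩
    sumℤ (suc n) (λ k → + suc k * column (suc k) n * f k)
  ≡⟨ sumℤ-cong (suc n) (λ k _ → *-CS.xy∙z≈y∙xz (+ suc k) (column (suc k) n) (f k)) ⟩
    sumℤ (suc n) (λ k → column (suc k) n * mulX f (suc k))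
  ≡⟨ ℤP.+-identityˡ _ ⟨
    + 0 + sumℤ (suc n) (λ k → column (suc k) n * mulX f (suc k))
  ≡⟨ cong (_+ sumℤ (suc n) (λ k → column (suc k) n * mulX f (suc k))) (ℤP.*-zeroʳ (column 0 n)) ⟨
    column 0 n * mulX f 0 + sumℤ (suc n) (λ k → column (suc k) n * mulX f (suc k))
  ≡⟨ sumℤ-head (suc n) (λ k → column k n * mulX f k) ⟨
    sumℤ (suc (suc n)) (λ k → column k n * mulX f k)
  ≡⟨ stirling-extend (mulX f) (suc (suc n)) (ℕP.m<n⇒m<1+n (ℕP.n<1+n n)) ⟨
    stirling (mulX f) n
  ∎
  where open ≡-Reasoning

stirling-δ : ∀ n → stirling δ n ≡ δ n
stirling-δ n = begin
    stirling δ n                                       ≡⟨ sumℤ-head n (λ k → column k n * δ k) ⟩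
    column 0 n * + 1 + sumℤ n (λ k → column (suc k) n * + 0)
      ≡⟨ cong₂ _+_ (ℤP.*-identityʳ (column 0 n)) (sumℤ-zero n (λ k _ → ℤP.*-zeroʳ (column (suc k) n))) ⟩
    column 0 n + + 0                                   ≡⟨ ℤP.+-identityʳ (column 0 n) ⟩
    column 0 n                                         ≡⟨ column-zero n ⟩
    δ n                                                ∎
  where
  open ≡-Reasoning
  column-zero : ∀ n → column 0 n ≡ δ n
  column-zero zero    = refl
  column-zero (suc n) = refl

orderedBell : Seq
orderedBell n = + w n

factorial : Seq
factorial k = + (k !)

orderedBell≡stirling-factorial : ∀ n → orderedBell n ≡ stirling factorial n
orderedBell≡stirling-factorial n =
  trans (pos-sumℕ (suc n) (λ k → S2 n k ℕ.* k !)) (sumℤ-cong (suc n) (λ k _ → ℤP.pos-* (S2 n k) (k !)))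

mulX-factorial : ∀ k → mulX factorial k ≡ factorial k - δ k
mulX-factorial zero    = refl
mulX-factorial (suc k) = sym (trans (ℤP.+-identityʳ (+ (suc k !))) (ℤP.pos-* (suc k) (k !)))

orderedBell-⋆-u : ∀ n → (orderedBell ⋆ u) n ≡ orderedBell n - δ n
orderedBell-⋆-u n = begin
    (orderedBell ⋆ u) n
  ≡⟨ ⋆-congˡ n u (λ m _ → orderedBell≡stirling-factorial m) ⟩
    (stirling factorial ⋆ u) n
  ≡⟨ stirling-⋆-u factorial n ⟩
    stirling (mulX factorial) n
  ≡⟨ sumℤ-cong (suc n) (λ k _ → trans (cong (column k n *_) (mulX-factorial k))
                                      (x[y-z]≈xy-xz (column k n) (factorial k) (δ k))) ⟩
    sumℤ (suc n) (λ k → column k n * factorial k - column k n * δ k)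
  ≡⟨ sumℤ-distrib-- (suc n) (λ k → column k n * factorial k) (λ k → column k n * δ k) ⟩
    stirling factorial n - stirling δ n
  ≡⟨ cong₂ _-_ (sym (orderedBell≡stirling-factorial n)) (stirling-δ n) ⟩
    orderedBell n - δ n
  ∎
  where open ≡-Reasoning

[k+1]*[n+1]C[k+1]≡[n+1]*nCk : ∀ n k → suc k ℕ.* (suc n C suc k) ≡ suc n ℕ.* (n C k)
[k+1]*[n+1]C[k+1]≡[n+1]*nCk zero    zero    = refl
[k+1]*[n+1]C[k+1]≡[n+1]*nCk zero    (suc k)
  rewrite k>n⇒nCk≡0 {1} {suc (suc k)} (s≤s (s≤s z≤n)) | k>n⇒nCk≡0 {0} {suc k} (s≤s z≤n) = ℕP.*-zeroʳ (suc (suc k))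
[k+1]*[n+1]C[k+1]≡[n+1]*nCk (suc n) zero
  rewrite nC1≡n (suc (suc n)) = trans (ℕP.+-identityʳ (suc (suc n))) (sym (ℕP.*-identityʳ (suc (suc n))))
[k+1]*[n+1]C[k+1]≡[n+1]*nCk (suc n) (suc k) = begin
    suc (suc k) ℕ.* (suc (suc n) C suc (suc k))
  ≡⟨ cong (suc (suc k) ℕ.*_) (nCk+nC[k+1]≡[n+1]C[k+1] (suc n) (suc k)) ⟨
    suc (suc k) ℕ.* (P ℕ.+ Q)
  ≡⟨ expand k P Q ⟩
    suc k ℕ.* P ℕ.+ P ℕ.+ suc (suc k) ℕ.* Q
  ≡⟨ cong₂ (λ x y → x ℕ.+ P ℕ.+ y) ([k+1]*[n+1]C[k+1]≡[n+1]*nCk n k) ([k+1]*[n+1]C[k+1]≡[n+1]*nCk n (suc k)) ⟩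
    suc n ℕ.* (n C k) ℕ.+ P ℕ.+ suc n ℕ.* (n C suc k)
  ≡⟨ factor n (n C k) (n C suc k) P ⟩
    suc n ℕ.* (n C k ℕ.+ n C suc k) ℕ.+ P
  ≡⟨ cong (λ x → suc n ℕ.* x ℕ.+ P) (nCk+nC[k+1]≡[n+1]C[k+1] n k) ⟩
    suc n ℕ.* P ℕ.+ P
  ≡⟨ ℕP.+-comm (suc n ℕ.* P) P ⟩
    suc (suc n) ℕ.* P
  ∎
  where
  open ≡-Reasoning
  P Q : ℕ
  P = suc n C suc k
  Q = suc n C suc (suc k)
  expand : ∀ k P Q → suc (suc k) ℕ.* (P ℕ.+ Q) ≡ suc k ℕ.* P ℕ.+ P ℕ.+ suc (suc k) ℕ.* Q
  expand = ℕ-Solver.solve-∀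
  factor : ∀ n A B P → suc n ℕ.* A ℕ.+ P ℕ.+ suc n ℕ.* B ≡ suc n ℕ.* (A ℕ.+ B) ℕ.+ P
  factor = ℕ-Solver.solve-∀

[r+1]*d[k+1,r+1]≡[k+1]*d[k,r] : ∀ k r → + suc r * dkr (suc k) (suc r) ≡ + suc k * dkr k r
[r+1]*d[k+1,r+1]≡[k+1]*d[k,r] k r with suc r ℕ.≤? suc k | r ℕ.≤? k
... | yes _     | yes _   = begin
    + suc r * (+ (suc k C suc r) * der (k ∸ r))    ≡⟨ ℤP.*-assoc (+ suc r) (+ (suc k C suc r)) (der (k ∸ r)) ⟨
    + suc r * + (suc k C suc r) * der (k ∸ r)      ≡⟨ cong (_* der (k ∸ r)) binomials ⟩
    + suc k * + (k C r) * der (k ∸ r)              ≡⟨ ℤP.*-assoc (+ suc k) (+ (k C r)) (der (k ∸ r)) ⟩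
    + suc k * (+ (k C r) * der (k ∸ r))            ∎
  where
  open ≡-Reasoning
  binomials : + suc r * + (suc k C suc r) ≡ + suc k * + (k C r)
  binomials = trans (sym (ℤP.pos-* (suc r) (suc k C suc r)))
                    (trans (cong +_ ([k+1]*[n+1]C[k+1]≡[n+1]*nCk k r)) (ℤP.pos-* (suc k) (k C r)))
... | yes r+1≤k+1 | no r≰k  = ⊥-elim (r≰k (ℕP.≤-pred r+1≤k+1))
... | no r+1≰k+1  | yes r≤k = ⊥-elim (r+1≰k+1 (s≤s r≤k))
... | no _      | no _    = trans (ℤP.*-zeroʳ (+ suc r)) (sym (ℤP.*-zeroʳ (+ suc k)))

k<r⇒dkr≡0 : ∀ {k r} → k < r → dkr k r ≡ + 0
k<r⇒dkr≡0 {k} {r} k<r with r ℕ.≤? k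
... | yes r≤k = ⊥-elim (ℕP.<⇒≱ k<r r≤k)
... | no _    = refl

n<r⇒wt≡0 : ∀ {n r} → n < r → wt n r ≡ + 0
n<r⇒wt≡0 {n} n<r = sumℤ-zero (suc n) (λ k k≤n →
  trans (cong (column k n *_) (k<r⇒dkr≡0 (ℕP.<-≤-trans k≤n n<r))) (ℤP.*-zeroʳ (column k n)))

mulX-dkr : ∀ r k → mulX (λ k → dkr k r) k ≡ + suc r * dkr k (suc r)
mulX-dkr r zero    = sym (trans (cong (+ suc r *_) (k<r⇒dkr≡0 {0} {suc r} (s≤s z≤n))) (ℤP.*-zeroʳ (+ suc r)))
mulX-dkr r (suc k) = sym ([r+1]*d[k+1,r+1]≡[k+1]*d[k,r] k r)

[r+1]*wt[n,r+1]≡wt[·,r]⋆u : ∀ n r → + suc r * wt n (suc r) ≡ ((λ j → wt j r) ⋆ u) n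
[r+1]*wt[n,r+1]≡wt[·,r]⋆u n r = begin
    + suc r * wt n (suc r)
  ≡⟨ *-distribˡ-sumℤ (suc n) (+ suc r) (λ k → column k n * dkr k (suc r)) ⟩
    sumℤ (suc n) (λ k → + suc r * (column k n * dkr k (suc r)))
  ≡⟨ sumℤ-cong (suc n) (λ k _ → trans (*-CS.x∙yz≈y∙xz (+ suc r) (column k n) (dkr k (suc r)))
                                      (cong (column k n *_) (sym (mulX-dkr r k)))) ⟩
    stirling (mulX (λ k → dkr k r)) n
  ≡⟨ stirling-⋆-u (λ k → dkr k r) n ⟨
    ((λ j → wt j r) ⋆ u) n
  ∎
  where open ≡-Reasoning

mainTheorem6 : (n r : ℕ) → suc r ≤ n →
    + suc r * wt n (suc r)
      ≡ sumRangeℤ r n (λ j → + (n C j) * + w (n ∸ j) * (wt j r - + suc r * wt j (suc r)))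
mainTheorem6 n r r<n = begin
    b n                               ≡⟨ x-[x-y]≡y (a n) (b n) ⟨
    a n - c n                         ≡⟨ cong (_- c n) c⋆w≡a ⟨
    (c ⋆ orderedBell) n - c n         ≡⟨ cong (λ z → sumℤ n T + z - c n) Tn≡cn ⟩
    sumℤ n T + c n - c n              ≡⟨ x+y-y≡x (sumℤ n T) (c n) ⟩
    sumℤ n T                          ≡⟨ sumRangeℤ≡sumℤ r n T (ℕP.<⇒≤ r<n) Tj≡0 ⟨
    sumRangeℤ r n T                   ∎
  where
  open ≡-Reasoning
  a b c : Seq
  a j = wt j r
  b j = + suc r * wt j (suc r)
  c j = a j - b j
  T : Seq
  T j = + (n C j) * orderedBell (n ∸ j) * c j

  c⋆w≡a : (c ⋆ orderedBell) n ≡ a n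
  c⋆w≡a = trans (⋆-congˡ n orderedBell (λ m _ → cong (a m -_) ([r+1]*wt[n,r+1]≡wt[·,r]⋆u m r)))
                (⋆-u-cancel orderedBell-⋆-u a n)
  Tn≡cn : T n ≡ c n
  Tn≡cn rewrite nCn≡1 n | ℕP.n∸n≡0 n = ℤP.*-identityˡ (c n)
  Tj≡0 : ∀ j → j < r → T j ≡ + 0
  Tj≡0 j j<r = trans (cong (+ (n C j) * orderedBell (n ∸ j) *_) cj≡0) (ℤP.*-zeroʳ (+ (n C j) * orderedBell (n ∸ j)))
    where
    cj≡0 : c j ≡ + 0
    cj≡0 = cong₂ _-_ (n<r⇒wt≡0 j<r)
                     (trans (cong (+ suc r *_) (n<r⇒wt≡0 (ℕP.m<n⇒m<1+n j<r))) (ℤP.*-zeroʳ (+ suc r)))
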